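{- For every positive integer $n$, there is a bijection between the states of the robot $QR_n$ and the order ideals of the poset $QP_n$.
   Context: The states of the positive robotic arm $QR_n$ are the lattice paths of length $n$ starting at $(0,0)$ with steps north or east (equivalently, the subsets of $[n]$ recording the indices of north steps). The poset $QP_n$ is the set of lattice points $(x,y)\in\mathbb{Z}^2$ with $y\ge 0$, $y\le x$, $x\le n-1$, ordered componentwise: $(x,y)\le(x',y')$ iff $x\le x'$ and $y\le y'$. An order ideal is a subset $I$ with $a\le b$, $b\in I$ implying $a\in I$. -}

module Defs where

open import Level using (0ℓ)
open import Data.Nat using (ℕ; _≤_; _<_)
open import Data.Bool using (Bool; true; false)
open import Data.Vec using (Vec)
open import Data.Product using (Σ; _×_; _,_; proj₁)
open import Relation.Binary.PropositionalEquality using (_≡_; refl; sym; trans; setoid)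
open import Relation.Binary.Bundles using (Setoid)

-- States of the positive robotic arm QR_n: lattice paths of length n from (0,0)
-- with steps north or east, encoded as the sequence of steps
-- (true = north step, false = east step).
QR : ℕ → Set
QR n = Vec Bool n

-- Points of the poset QP_n: lattice points (x , y) with 0 ≤ y ≤ x ≤ n - 1.
-- (x ≤ n - 1 is written x < n; y ≥ 0 is automatic for y : ℕ.)
record QP (n : ℕ) : Set where
  constructor pt
  field
    x   : ℕ
    y   : ℕ
    y≤x : y ≤ x
    x<n : x < n
open QP public

_≤QP_ : ∀ {n} → QP n → QP n → Set
p ≤QP q = (x p ≤ x q) × (y p ≤ y q)

Subset : ℕ → Set
Subset n = QP n → Bool

IsOrderIdeal : ∀ {n} → Subset n → Set
IsOrderIdeal {n} I = (a b : QP n) → a ≤QP b → I b ≡ true → I a ≡ true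

OrderIdeal : ℕ → Set
OrderIdeal n = Σ (Subset n) IsOrderIdeal

_≈I_ : ∀ {n} → OrderIdeal n → OrderIdeal n → Set
I ≈I J = ∀ p → proj₁ I p ≡ proj₁ J p

OrderIdealSetoid : ℕ → Setoid 0ℓ 0ℓ
OrderIdealSetoid n = record
  { Carrier = OrderIdeal n
  ; _≈_ = _≈I_
  ; isEquivalence = record
    { refl = λ p → refl
    ; sym = λ e p → sym (e p)
    ; trans = λ e f p → trans (e p) (f p)
    }
  }

QRSetoid : ℕ → Setoid 0ℓ 0ℓ
QRSetoid n = setoid (QR n)

module Submission where

-- A path of length n+1 is determined by its first step and a path of length n,
-- and the first step is read off from whether the corner (n, 0) lies in the
-- ideal.  If it does not, no point of the last column x = n does, so the ideal
-- is an ideal of QP_n.  If it does, the ideal contains the whole bottom row,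
-- and the remaining points form an ideal of QP_n translated by (1, 1).  The
-- map from paths to ideals is defined by this recursion and inverted by it.

open import Defs
open import Data.Bool using (Bool; true; false)
open import Data.Bool.Properties using (T-≡; ¬-not)
open import Data.Nat using (ℕ; zero; suc; _≤_; _<_; _<ᵇ_; z≤n; s≤s)
open import Data.Nat.Properties
  using (≤-irrelevant; ≤-refl; ≤-pred; <-irrefl; ≤-<-trans; m<n⇒m<1+n; m<1+n⇒m<n∨m≡n; <ᵇ⇒<; <⇒<ᵇ)
open import Data.Product using (Σ; _,_; proj₁)
open import Data.Sum using (inj₁; inj₂)
open import Data.Vec using ([]; _∷_)
open import Function.Base using (_∘_)
open import Function.Bundles using (Bijection; Equivalence)
open import Relation.Binary.PropositionalEquality using (_≡_; refl; sym; trans; cong; cong₂)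
open import Relation.Nullary using (contradiction)

<⇒<ᵇ≡true : ∀ {m n} → m < n → (m <ᵇ n) ≡ true
<⇒<ᵇ≡true = Equivalence.to T-≡ ∘ <⇒<ᵇ

<ᵇ≡true⇒< : ∀ m n → (m <ᵇ n) ≡ true → m < n
<ᵇ≡true⇒< m n = <ᵇ⇒< m n ∘ Equivalence.from T-≡

pt-irrelevant : ∀ {n x y} {a a′ : y ≤ x} {b b′ : x < n} → pt {n} x y a b ≡ pt x y a′ b′
pt-irrelevant {x = x} {y} {a} {a′} {b} {b′} = cong₂ (pt x y) (≤-irrelevant a a′) (≤-irrelevant b b′)

corner : ∀ n → QP (suc n)
corner n = pt n 0 z≤n ≤-refl

embed : ∀ {n} → QP n → QP (suc n)
embed (pt x y y≤x x<n) = pt x y y≤x (m<n⇒m<1+n x<n)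

translate : ∀ {n} → QP n → QP (suc n)
translate (pt x y y≤x x<n) = pt (suc x) (suc y) (s≤s y≤x) (s≤s x<n)

nonmember-upward : ∀ {n} (I : OrderIdeal n) {a b : QP n} →
                   a ≤QP b → proj₁ I a ≡ false → proj₁ I b ≡ false
nonmember-upward (I , downward) {a} {b} a≤b a∉I =
  ¬-not (λ b∈I → contradiction (trans (sym a∉I) (downward a b a≤b b∈I)) λ ())

restrict : ∀ {n} → OrderIdeal (suc n) → OrderIdeal n
restrict (I , downward) = I ∘ embed , λ a b → downward (embed a) (embed b)

untranslate : ∀ {n} → OrderIdeal (suc n) → OrderIdeal n
untranslate (I , downward) =
  I ∘ translate , λ a b (x≤ , y≤) → downward (translate a) (translate b) (s≤s x≤ , s≤s y≤)

-- Defined on all of ℕ × ℕ; the bound in the bottom-row clause keeps every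
-- member inside QP_n, so that the corner (n, 0) detects the first step.
ideal : ∀ {n} → QR n → ℕ → ℕ → Bool
ideal []                  x       y       = false
ideal (false ∷ v)         x       y       = ideal v x y
ideal {suc n} (true ∷ v)  x       zero    = x <ᵇ suc n
ideal (true ∷ v)          zero    (suc y) = false
ideal (true ∷ v)          (suc x) (suc y) = ideal v x y

ideal-bounded : ∀ {n} (v : QR n) {x y} → ideal v x y ≡ true → x < n
ideal-bounded (false ∷ v)        e = m<n⇒m<1+n (ideal-bounded v e)
ideal-bounded {suc n} (true ∷ v) {x} {zero}  e = <ᵇ≡true⇒< x (suc n) e
ideal-bounded (true ∷ v) {suc x} {suc y}     e = s≤s (ideal-bounded v e)

ideal-outside : ∀ {n} (v : QR n) y → ideal v n y ≡ false
ideal-outside v y = ¬-not (λ e → <-irrefl refl (ideal-bounded v e))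

ideal-downward : ∀ {n} (v : QR n) {x y x′ y′} → y′ ≤ x′ → x′ ≤ x → y′ ≤ y →
                 ideal v x y ≡ true → ideal v x′ y′ ≡ true
ideal-downward (false ∷ v) y′≤x′ x′≤x y′≤y e = ideal-downward v y′≤x′ x′≤x y′≤y e
ideal-downward (true ∷ v) {x} {y} {y′ = zero} _ x′≤x _ e =
  <⇒<ᵇ≡true (≤-<-trans x′≤x (ideal-bounded (true ∷ v) {x} {y} e))
ideal-downward (true ∷ v) {suc x} {suc y} {suc x′} {suc y′} (s≤s y′≤x′) (s≤s x′≤x) (s≤s y′≤y) e =
  ideal-downward v y′≤x′ x′≤x y′≤y e

toOrderIdeal : ∀ {n} → QR n → OrderIdeal n
toOrderIdeal v = (λ p → ideal v (x p) (y p)) , λ a b (x≤ , y≤) → ideal-downward v (y≤x a) x≤ y≤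

ideal-corner : ∀ {n} b (v : QR n) → ideal (b ∷ v) n 0 ≡ b
ideal-corner false v = ideal-outside v 0
ideal-corner {n} true v = <⇒<ᵇ≡true {n} ≤-refl

first-steps-agree : ∀ {n} b c (u v : QR n) → toOrderIdeal (b ∷ u) ≈I toOrderIdeal (c ∷ v) → b ≡ c
first-steps-agree {n} b c u v h = trans (sym (ideal-corner b u)) (trans (h (corner n)) (ideal-corner c v))

toOrderIdeal-injective : ∀ {n} (u v : QR n) → toOrderIdeal u ≈I toOrderIdeal v → u ≡ v
toOrderIdeal-injective []          []          _ = refl
toOrderIdeal-injective (false ∷ u) (false ∷ v) h =
  cong (false ∷_) (toOrderIdeal-injective u v (h ∘ embed))
toOrderIdeal-injective (true ∷ u)  (true ∷ v)  h =
  cong (true ∷_) (toOrderIdeal-injective u v (h ∘ translate))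
toOrderIdeal-injective (false ∷ u) (true ∷ v)  h = contradiction (first-steps-agree false true u v h) λ ()
toOrderIdeal-injective (true ∷ u)  (false ∷ v) h = contradiction (first-steps-agree true false u v h) λ ()

east-step : ∀ {n} (I : OrderIdeal (suc n)) {v : QR n} → proj₁ I (corner n) ≡ false →
            toOrderIdeal v ≈I restrict I → toOrderIdeal (false ∷ v) ≈I I
east-step I {v} corner∉I h (pt x y y≤x x<1+n) with m<1+n⇒m<n∨m≡n x<1+n
... | inj₁ x<n  = trans (h (pt x y y≤x x<n)) (cong (proj₁ I) pt-irrelevant)
... | inj₂ refl = trans (ideal-outside v y) (sym (nonmember-upward I (≤-refl , z≤n) corner∉I))

north-step : ∀ {n} (I : OrderIdeal (suc n)) {v : QR n} → proj₁ I (corner n) ≡ true →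
             toOrderIdeal v ≈I untranslate I → toOrderIdeal (true ∷ v) ≈I I
north-step (I , downward) corner∈I h p@(pt x zero _ x<1+n) =
  trans (<⇒<ᵇ≡true x<1+n) (sym (downward p _ (≤-pred x<1+n , z≤n) corner∈I))
north-step I corner∈I h (pt (suc x) (suc y) (s≤s y≤x) (s≤s x<n)) = h (pt x y y≤x x<n)

toOrderIdeal-surjective : ∀ {n} (I : OrderIdeal n) → Σ (QR n) (λ v → toOrderIdeal v ≈I I)
toOrderIdeal-surjective {zero} I = [] , λ ()
toOrderIdeal-surjective {suc n} I with proj₁ I (corner n) in corner∈?I
... | false = let v , h = toOrderIdeal-surjective (restrict I)
              in  false ∷ v , east-step I {v} corner∈?I h
... | true  = let v , h = toOrderIdeal-surjective (untranslate I)
              in  true ∷ v , north-step I {v} corner∈?I h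

-- The bijection exists for n = 0 as well.
proposition4p2 : (n : ℕ) → 0 < n → Bijection (QRSetoid n) (OrderIdealSetoid n)
proposition4p2 n _ = record
  { to        = toOrderIdeal
  ; cong      = λ { refl p → refl }
  ; bijective = (λ {u} {v} → toOrderIdeal-injective u v)
              , λ I → let v , h = toOrderIdeal-surjective I in v , λ { refl → h }
  }
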